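{- Let $G$ be a local amoeba of order $n$ with minimum degree $\delta$ and maximum degree $\Delta$. Then for every integer $r$ with $\delta\le r\le\Delta$ there is a vertex $v\in V(G)$ with $\deg_G(v)=r$.
   Context: For a graph $G$ on vertex set $V=\{v_1,\dots,v_n\}$ let $L_G=\{ij: v_iv_j\in E(G)\}$; for $\sigma\in S_n$, $G_\sigma$ is the graph on $V$ with $E(G_\sigma)=\{v_{\sigma^{ -1}(i)}v_{\sigma^{ -1}(j)}: ij\in L_G\}$. An edge-replacement $e\to e'$ ($e\in E(G)$, $e'\in E(\overline G)\cup\{e\}$) is feasible if $G-e+e'\cong G$. Let $R_G$ be the set of feasible replacements $rs\to kl$ (meaning $v_rv_s\to v_kv_l$), $S_G(rs\to kl)=\{\sigma\in S_n: G_\sigma=G-v_rv_s+v_kv_l\}$, and $S_G\le S_n$ the group generated by $\bigcup_{rs\to kl\in R_G}S_G(rs\to kl)$. $G$ is a local amoeba if $S_G=S_n$. -}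

module Defs where

open import Data.Nat using (ℕ; _≤_)
open import Data.Fin using (Fin; _≟_)
open import Data.Fin.Permutation using (Permutation′; _⟨$⟩ʳ_; id; flip; _∘ₚ_; _≈_)
open import Data.Bool using (Bool; true; false; if_then_else_; _∧_; _∨_)
open import Data.List using (length; filterᵇ; allFin)
open import Data.Product using (Σ; ∃; _×_; _,_)
open import Data.Sum using (_⊎_)
open import Relation.Nullary using (¬_)
open import Relation.Nullary.Decidable using (⌊_⌋)
open import Relation.Binary.PropositionalEquality using (_≡_)

-- A finite simple graph on vertex set {v_0,…,v_{n-1}} (vertex v_i ↔ i : Fin n),
-- given by a symmetric irreflexive Boolean adjacency relation.
record Graph (n : ℕ) : Set where
  field
    adj  : Fin n → Fin n → Bool
    sym  : ∀ i j → adj i j ≡ adj j i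
    irr  : ∀ i → adj i i ≡ false
open Graph public

deg : ∀ {n} → Graph n → Fin n → ℕ
deg G v = length (filterᵇ (adj G v) (allFin _))

samePair : ∀ {n} → Fin n → Fin n → Fin n → Fin n → Bool
samePair a b k l = (⌊ a ≟ k ⌋ ∧ ⌊ b ≟ l ⌋) ∨ (⌊ a ≟ l ⌋ ∧ ⌊ b ≟ k ⌋)

replaceAdj : ∀ {n} → Graph n → (r s k l : Fin n) → Fin n → Fin n → Bool
replaceAdj G r s k l a b =
  if samePair a b k l then true
  else if samePair a b r s then false
  else adj G a b

-- rs → kl is an edge-replacement: v_r v_s ∈ E(G), v_k v_l ∈ E(complement G) ∪ {v_r v_s}
IsReplacement : ∀ {n} → Graph n → (r s k l : Fin n) → Set
IsReplacement G r s k l =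
  adj G r s ≡ true ×
  ((¬ (k ≡ l) × adj G k l ≡ false) ⊎ samePair k l r s ≡ true)

-- G_σ = G - v_r v_s + v_k v_l  (G_σ has v_a v_b as edge iff v_{σ(a)} v_{σ(b)} ∈ E(G))
InS : ∀ {n} → Graph n → (r s k l : Fin n) → Permutation′ n → Set
InS G r s k l σ = ∀ a b → adj G (σ ⟨$⟩ʳ a) (σ ⟨$⟩ʳ b) ≡ replaceAdj G r s k l a b

Feasible : ∀ {n} → Graph n → (r s k l : Fin n) → Set
Feasible G r s k l = IsReplacement G r s k l × ∃ λ σ → InS G r s k l σ

Generator : ∀ {n} → Graph n → Permutation′ n → Set
Generator G σ = ∃ λ r → ∃ λ s → ∃ λ k → ∃ λ l → Feasible G r s k l × InS G r s k l σ

-- subgroup of S_n generated by a set P (permutations identified extensionally)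
data ⟨_⟩ {n : ℕ} (P : Permutation′ n → Set) : Permutation′ n → Set where
  gen  : ∀ {σ} → P σ → ⟨ P ⟩ σ
  one  : ⟨ P ⟩ id
  comp : ∀ {σ τ} → ⟨ P ⟩ σ → ⟨ P ⟩ τ → ⟨ P ⟩ (σ ∘ₚ τ)
  inv  : ∀ {σ} → ⟨ P ⟩ σ → ⟨ P ⟩ (flip σ)
  ext  : ∀ {σ τ} → σ ≈ τ → ⟨ P ⟩ σ → ⟨ P ⟩ τ

LocalAmoeba : ∀ {n} → Graph n → Set
LocalAmoeba G = ∀ σ → ⟨ Generator G ⟩ σ

IsMinDegree : ∀ {n} → Graph n → ℕ → Set
IsMinDegree G δ = (∃ λ v → deg G v ≡ δ) × (∀ v → δ ≤ deg G v)

IsMaxDegree : ∀ {n} → Graph n → ℕ → Set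
IsMaxDegree G Δ = (∃ λ v → deg G v ≡ Δ) × (∀ v → deg G v ≤ Δ)

module Submission where

-- Suppose no vertex has degree r, with
-- δ ≤ r ≤ Δ.  An edge replacement e → e' changes every degree by at most one,
-- and a permutation σ ∈ S_G(rs → kl) satisfies deg_G(σ a) = deg_{G-e+e'}(a).
-- Hence every generator σ of S_G moves each vertex a to a vertex σ a with
-- |deg(σ a) - deg(a)| ≤ 1; as the value r is skipped, σ a has degree below r
-- exactly when a does.  This "stays on its side of r" property is closed under
-- the group operations, so all of S_G has it.  But the transposition of a
-- vertex of degree δ < r with a vertex of degree Δ > r does not, so S_G ≠ S_n.

open import Defs
open import Data.Nat using (ℕ; _≤_)
open import Data.Fin using (Fin)
open import Data.Product using (∃)
open import Relation.Binary.PropositionalEquality using (_≡_)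

open import Data.Nat as ℕ using (zero; suc; _<_; z≤n)
open import Data.Nat.Properties
  using (≤-refl; ≤-trans; +-mono-≤; +-suc; m≤n+m; m≤n⇒m<n∨m≡n; <-asym; +-0-commutativeMonoid)
open import Data.Fin using (zero; suc; _≟_)
open import Data.Fin.Properties using (any?; suc-injective; 0≢1+n)
open import Data.Fin.Permutation using (Permutation′; _⟨$⟩ʳ_; _⟨$⟩ˡ_; inverseʳ; transpose)
open import Data.Bool using (Bool; true; false)
open import Data.List using (length; filterᵇ; tabulate)
open import Data.Product using (_×_; _,_; proj₁; proj₂)
open import Data.Sum using (inj₁; inj₂)
open import Data.Empty using (⊥; ⊥-elim)
open import Relation.Nullary using (¬_; yes; no)
open import Relation.Nullary.Decidable using (dec-true)
open import Relation.Binary.PropositionalEquality using (refl; trans; cong; subst) renaming (sym to ≡-sym)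
open import Relation.Binary.Structures using (IsEquivalence)
open import Function using (_∘_; _⇔_; mk⇔; Equivalence)
open import Function.Properties.Equivalence using (⇔-isEquivalence)
open import Level using (0ℓ)
open import Algebra.Properties.CommutativeMonoid.Sum +-0-commutativeMonoid
  using (sum; sum-permute; sum-cong-≗)

open IsEquivalence (⇔-isEquivalence {ℓ = 0ℓ}) using () renaming (refl to ⇔-refl; sym to ⇔-sym; trans to ⇔-trans)
open Equivalence using (to)

indicator : Bool → ℕ
indicator true  = 1
indicator false = 0

count : ∀ {n} → (Fin n → Bool) → ℕ
count f = sum (indicator ∘ f)

length-filter-tabulate : ∀ {n} {A : Set} (p : A → Bool) (g : Fin n → A) →
  length (filterᵇ p (tabulate g)) ≡ count (p ∘ g)
length-filter-tabulate {zero}  p g = refl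
length-filter-tabulate {suc n} p g with p (g zero)
... | true  = cong suc (length-filter-tabulate p (g ∘ suc))
... | false = length-filter-tabulate p (g ∘ suc)

deg≡count : ∀ {n} (G : Graph n) (v : Fin n) → deg G v ≡ count (adj G v)
deg≡count G v = length-filter-tabulate (adj G v) (λ x → x)

indicator≤1 : ∀ x → indicator x ≤ 1
indicator≤1 true  = ≤-refl
indicator≤1 false = z≤n

indicator-mono : ∀ {x y} → (x ≡ true → y ≡ false → ⊥) → indicator x ≤ indicator y
indicator-mono {false}         _ = z≤n
indicator-mono {true} {true}   _ = ≤-refl
indicator-mono {true} {false}  h = ⊥-elim (h refl refl)

ExceedsOnlyAt : ∀ {n} → (f g : Fin n → Bool) → Fin n → Set
ExceedsOnlyAt f g b₀ = ∀ b → f b ≡ true → g b ≡ false → b ≡ b₀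

count-mono : ∀ {n} (f g : Fin n → Bool) → (∀ b → f b ≡ true → g b ≡ false → ⊥) → count f ≤ count g
count-mono {zero}  f g h = z≤n
count-mono {suc n} f g h = +-mono-≤ (indicator-mono (h zero)) (count-mono (f ∘ suc) (g ∘ suc) (h ∘ suc))

count-exceedsOnlyAt : ∀ {n} (f g : Fin n → Bool) (b₀ : Fin n) → ExceedsOnlyAt f g b₀ → count f ≤ suc (count g)
count-exceedsOnlyAt {suc n} f g zero h =
  +-mono-≤ (indicator≤1 (f zero))
    (≤-trans (count-mono (f ∘ suc) (g ∘ suc) (λ b p q → 0≢1+n (≡-sym (h (suc b) p q))))
             (m≤n+m _ (indicator (g zero))))
count-exceedsOnlyAt {suc n} f g (suc b₀) h =
  subst (count f ≤_) (+-suc (indicator (g zero)) (count (g ∘ suc)))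
    (+-mono-≤ (indicator-mono (λ p q → 0≢1+n (h zero p q)))
              (count-exceedsOnlyAt (f ∘ suc) (g ∘ suc) b₀ (λ b p q → suc-injective (h (suc b) p q))))

partner : ∀ {n} → Fin n → Fin n → Fin n → Fin n
partner a k l with a ≟ k
... | yes _ = l
... | no  _ = k

samePair⇒partner : ∀ {n} (a b k l : Fin n) → samePair a b k l ≡ true → b ≡ partner a k l
samePair⇒partner a b k l e with a ≟ k | b ≟ l | a ≟ l | b ≟ k
... | yes _  | yes b≡l | _      | _       = b≡l
... | yes a≡k | no _   | yes a≡l | yes b≡k = trans b≡k (trans (≡-sym a≡k) a≡l)
... | yes _  | no _    | yes _  | no _    with () ← e
... | yes _  | no _    | no _   | _       with () ← e
... | no _   | _       | yes _  | yes b≡k = b≡k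
... | no _   | _       | yes _  | no _    with () ← e
... | no _   | _       | no _   | _       with () ← e

replaced-row-gains : ∀ {n} (G : Graph n) (r s k l a : Fin n) →
  ExceedsOnlyAt (replaceAdj G r s k l a) (adj G a) (partner a k l)
replaced-row-gains G r s k l a b new old with samePair a b k l in e
... | true = samePair⇒partner a b k l e
... | false with samePair a b r s
...   | true  with () ← new
...   | false with () ← trans (≡-sym new) old

replaced-row-loses : ∀ {n} (G : Graph n) (r s k l a : Fin n) →
  ExceedsOnlyAt (adj G a) (replaceAdj G r s k l a) (partner a r s)
replaced-row-loses G r s k l a b old new with samePair a b k l
... | true  with () ← new
... | false with samePair a b r s in e
...   | true  = samePair⇒partner a b r s e
...   | false with () ← trans (≡-sym old) new

InS-deg : ∀ {n} (G : Graph n) (r s k l : Fin n) (σ : Permutation′ n) → InS G r s k l σ →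
  ∀ a → deg G (σ ⟨$⟩ʳ a) ≡ count (replaceAdj G r s k l a)
InS-deg G r s k l σ σ∈S a = trans (deg≡count G (σ ⟨$⟩ʳ a))
  (trans (sum-permute (indicator ∘ adj G (σ ⟨$⟩ʳ a)) σ) (sum-cong-≗ (cong indicator ∘ σ∈S a)))

MovesByAtMostOne : ∀ {n} → (Fin n → ℕ) → Permutation′ n → Set
MovesByAtMostOne d σ = ∀ a → d (σ ⟨$⟩ʳ a) ≤ suc (d a) × d a ≤ suc (d (σ ⟨$⟩ʳ a))

generator-moves-deg : ∀ {n} (G : Graph n) (σ : Permutation′ n) → Generator G σ → MovesByAtMostOne (deg G) σ
generator-moves-deg G σ (r , s , k , l , _ , σ∈S) a =
  subst (_≤ suc (deg G a)) (≡-sym degσa) gains , subst (λ x → deg G a ≤ suc x) (≡-sym degσa) loses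
  where
  row : Fin _ → Bool
  row = replaceAdj G r s k l a
  degσa : deg G (σ ⟨$⟩ʳ a) ≡ count row
  degσa = InS-deg G r s k l σ σ∈S a
  gains : count row ≤ suc (deg G a)
  gains = subst (λ x → count row ≤ suc x) (≡-sym (deg≡count G a))
    (count-exceedsOnlyAt row (adj G a) _ (replaced-row-gains G r s k l a))
  loses : deg G a ≤ suc (count row)
  loses = subst (_≤ suc (count row)) (≡-sym (deg≡count G a))
    (count-exceedsOnlyAt (adj G a) row _ (replaced-row-loses G r s k l a))

≤∧≢⇒< : ∀ {x y} → x ≤ y → ¬ x ≡ y → x < y
≤∧≢⇒< x≤y x≢y with m≤n⇒m<n∨m≡n x≤y
... | inj₁ x<y = x<y
... | inj₂ x≡y = ⊥-elim (x≢y x≡y)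

module SkippedValue {n} (d : Fin n → ℕ) (r : ℕ) (skips : ∀ v → ¬ d v ≡ r) where

  PreservesSide : Permutation′ n → Set
  PreservesSide σ = ∀ a → (d a < r) ⇔ (d (σ ⟨$⟩ʳ a) < r)

  -- Since r is skipped, a step of size at most one cannot cross r.
  step-preserves : ∀ σ → MovesByAtMostOne d σ → PreservesSide σ
  step-preserves σ moves a = mk⇔
    (λ below → ≤∧≢⇒< (≤-trans (proj₁ (moves a)) below) (skips (σ ⟨$⟩ʳ a)))
    (λ below → ≤∧≢⇒< (≤-trans (proj₂ (moves a)) below) (skips a))

  subgroup-preserves : (P : Permutation′ n → Set) → (∀ σ → P σ → MovesByAtMostOne d σ) →
    ∀ σ → ⟨ P ⟩ σ → PreservesSide σ
  subgroup-preserves P gens σ (gen p)       = step-preserves σ (gens σ p)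
  subgroup-preserves P gens _ one a         = ⇔-refl
  subgroup-preserves P gens _ (comp {σ} {τ} p q) a =
    ⇔-trans (subgroup-preserves P gens σ p a) (subgroup-preserves P gens τ q (σ ⟨$⟩ʳ a))
  subgroup-preserves P gens _ (inv {σ} p) a =
    ⇔-sym (subst (λ b → (d (σ ⟨$⟩ˡ a) < r) ⇔ (d b < r)) (inverseʳ σ)
                 (subgroup-preserves P gens σ p (σ ⟨$⟩ˡ a)))
  subgroup-preserves P gens τ (ext {σ} σ≈τ p) a =
    subst (λ b → (d a < r) ⇔ (d b < r)) (σ≈τ a) (subgroup-preserves P gens σ p a)

transpose-maps : ∀ {n} (i j : Fin n) → transpose i j ⟨$⟩ʳ i ≡ j
transpose-maps i j rewrite dec-true (i ≟ i) refl = refl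

proposition3p3 : (n : ℕ) (G : Graph n) (δ Δ : ℕ) → LocalAmoeba G → IsMinDegree G δ → IsMaxDegree G Δ →
    (r : ℕ) → δ ≤ r → r ≤ Δ → ∃ λ (v : Fin n) → deg G v ≡ r
proposition3p3 n G δ Δ amoeba ((vmin , degmin) , _) ((vmax , degmax) , _) r δ≤r r≤Δ
  with any? (λ v → deg G v ℕ.≟ r)
... | yes found = found
... | no none = ⊥-elim (<-asym vmax-above (to swapped-side vmin-below))
  where
  skips : ∀ v → ¬ deg G v ≡ r
  skips v e = none (v , e)
  open SkippedValue (deg G) r skips
  vmin-below : deg G vmin < r
  vmin-below = ≤∧≢⇒< (subst (_≤ r) (≡-sym degmin) δ≤r) (skips vmin)
  vmax-above : r < deg G vmax
  vmax-above = ≤∧≢⇒< (subst (r ≤_) (≡-sym degmax) r≤Δ) (skips vmax ∘ ≡-sym)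
  swapped-side : (deg G vmin < r) ⇔ (deg G vmax < r)
  swapped-side = subst (λ v → (deg G vmin < r) ⇔ (deg G v < r)) (transpose-maps vmin vmax)
    (subgroup-preserves (Generator G) (generator-moves-deg G) _ (amoeba (transpose vmin vmax)) vmin)
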